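{- Let $M$ be a finite matroid, let $b(M)$ be the number of bases of $M$ and let $z(M)$ be the number of cyclic flats of $M$. Then $z(M) \leq b(M)$.
   Context: A cyclic flat of a matroid is a flat that is also a (possibly empty) union of circuits. -}

module Defs where

open import Level using (0ℓ)
open import Data.Nat using (ℕ; zero; suc; _<_; _⊔_)
open import Data.Nat.Properties using (_<?_)
open import Data.Bool using (Bool) renaming (_≟_ to _≟ᵇ_)
open import Data.Fin using (Fin)
open import Data.Fin.Subset
  using (Subset; _∈_; _∉_; _⊆_; _⊂_; ⁅_⁆; _∪_; ∣_∣; inside; outside)
  renaming (⊥ to ∅)
open import Data.Fin.Subset.Properties using (_∈?_; _⊆?_; _⊂?_; anySubset?)
open import Data.Fin.Properties using (all?)
open import Data.Vec using ([]; _∷_)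
open import Data.Vec.Properties using (≡-dec)
open import Data.List using (List; []; _∷_; _++_; map; filter; length; foldr)
open import Data.Product using (Σ; ∃; _×_; _,_)
open import Relation.Nullary using (¬_; Dec; yes; no; ¬?)
open import Relation.Nullary.Decidable using (_×-dec_; decidable-stable; map′)
open import Relation.Unary using (Pred; Decidable)
open import Relation.Binary.PropositionalEquality using (_≡_)

-- Independence is assumed decidable, which is
-- automatic classically for a finite matroid and is needed to count.
record Matroid (n : ℕ) : Set₁ where
  field
    Indep     : Pred (Subset n) 0ℓ
    Indep?    : Decidable Indep
    indep-∅   : Indep ∅
    indep-⊆   : ∀ {X Y} → Y ⊆ X → Indep X → Indep Y
    augment   : ∀ {X Y} → Indep X → Indep Y → ∣ X ∣ < ∣ Y ∣ →
                ∃ λ e → e ∈ Y × e ∉ X × Indep (⁅ e ⁆ ∪ X)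

allSubsets : ∀ n → List (Subset n)
allSubsets zero    = [] ∷ []
allSubsets (suc n) = map (outside ∷_) (allSubsets n) ++ map (inside ∷_) (allSubsets n)

count : ∀ {n} {P : Pred (Subset n) 0ℓ} → Decidable P → ℕ
count {n} P? = length (filter P? (allSubsets n))

allSubset? : ∀ {n} {P : Pred (Subset n) 0ℓ} → Decidable P → Dec (∀ X → P X)
allSubset? P? with anySubset? (λ X → ¬? (P? X))
... | yes (X , ¬PX) = no (λ h → ¬PX (h X))
... | no h = yes (λ X → decidable-stable (P? X) (λ ¬PX → h (X , ¬PX)))

module _ {n : ℕ} (M : Matroid n) where
  open Matroid M

  IsBasis : Pred (Subset n) 0ℓ
  IsBasis B = Indep B × (∀ X → B ⊆ X → Indep X → X ≡ B)

  IsCircuit : Pred (Subset n) 0ℓ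
  IsCircuit C = ¬ Indep C × (∀ X → X ⊂ C → Indep X)

  rank : Subset n → ℕ
  rank X = foldr _⊔_ 0 (map ∣_∣ (filter (λ Y → (Y ⊆? X) ×-dec Indep? Y) (allSubsets n)))

  IsFlat : Pred (Subset n) 0ℓ
  IsFlat F = ∀ e → e ∉ F → rank F < rank (⁅ e ⁆ ∪ F)

  IsUnionOfCircuits : Pred (Subset n) 0ℓ
  IsUnionOfCircuits F = ∀ e → e ∈ F → ∃ λ C → IsCircuit C × e ∈ C × C ⊆ F

  IsCyclicFlat : Pred (Subset n) 0ℓ
  IsCyclicFlat F = IsFlat F × IsUnionOfCircuits F

  private
    imp? : ∀ {A B : Set} → Dec A → Dec B → Dec (A → B)
    imp? (yes a) (yes b) = yes (λ _ → b)
    imp? (yes a) (no ¬b) = no (λ f → ¬b (f a))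
    imp? (no ¬a) _       = yes (λ a → Data.Empty.⊥-elim (¬a a))
      where import Data.Empty

  isBasis? : Decidable IsBasis
  isBasis? B = Indep? B ×-dec
    allSubset? (λ X → imp? (B ⊆? X) (imp? (Indep? X) (≡-dec _≟ᵇ_ X B)))

  isCircuit? : Decidable IsCircuit
  isCircuit? C = ¬? (Indep? C) ×-dec allSubset? (λ X → imp? (X ⊂? C) (Indep? X))

  isCyclicFlat? : Decidable IsCyclicFlat
  isCyclicFlat? F =
    all? (λ e → imp? (¬? (e ∈? F)) (rank F <? rank (⁅ e ⁆ ∪ F)))
    ×-dec
    all? (λ e → imp? (e ∈? F)
      (anySubset? (λ C → isCircuit? C ×-dec ((e ∈? C) ×-dec (C ⊆? F)))))

  numBases : ℕ
  numBases = count isBasis?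

  numCyclicFlats : ℕ
  numCyclicFlats = count isCyclicFlat?

{-# OPTIONS --safe #-}
-- Deletion–contraction at the element 0 of the ground set Fin (suc n).  Flatness and
-- being a union of circuits are rank conditions (e lies on a circuit inside F iff
-- r(F - e) = r(F)), and the rank functions of M ∖ 0 and M / 0 are X ↦ r(X) and
-- X ↦ r(X + 0) - 1.  Hence cyclic flats of M avoiding 0 are cyclic flats of M ∖ 0 and
-- those containing 0 give cyclic flats of M / 0, so z(M) ≤ z(M ∖ 0) + z(M / 0), while
-- b(M) = b(M ∖ 0) + b(M / 0) when 0 is neither a loop nor a coloop.  A loop lies in
-- every flat and a coloop in no cyclic flat, and in these two cases M ∖ 0 alone carries
-- the induction.
module Submission where

open import Defs
open import Level using (0ℓ)
open import Function.Base using (_∘_)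
open import Data.Nat using (ℕ; zero; suc; _+_; _<_; _≤_; _⊔_; s≤s; _≤?_)
open import Data.Nat.Properties
open import Data.Bool using (true; false)
open import Data.Fin using (Fin; zero; suc) renaming (_≟_ to _≟ᶠ_)
open import Data.Fin.Subset
open import Data.Fin.Subset.Properties
open import Data.Vec using ([]; _∷_; here; there)
open import Data.List using ([]; _∷_; _++_; map; filter; length)
open import Data.List.Properties using (filter-++; length-++; filter-none; foldr-forcesᵇ)
open import Data.List.Membership.Propositional using () renaming (_∈_ to _∈ˡ_)
open import Data.List.Membership.Propositional.Properties
  using (∈-++⁺ˡ; ∈-++⁺ʳ; ∈-map⁺; ∈-map⁻; ∈-filter⁺; ∈-filter⁻; foldr-selective)
open import Data.List.Relation.Unary.All as All using (universal)
open import Data.List.Relation.Unary.Any using (here)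
import Data.List.Relation.Binary.Sublist.Propositional as Sublist
import Data.List.Relation.Binary.Sublist.Propositional.Properties as Sublist
open import Data.Product using (∃; _×_; _,_; proj₁)
open import Data.Sum using (inj₁; inj₂)
open import Data.Empty using (⊥-elim)
open import Relation.Nullary using (¬_; yes; no; does; ¬?)
open import Relation.Nullary.Decidable using (_×-dec_; decidable-stable)
open import Relation.Unary using (Pred; Decidable)
open import Relation.Binary.PropositionalEquality

length-filter-map : ∀ {A B : Set} {P : Pred B 0ℓ} (P? : Decidable P) (f : A → B) xs →
                    length (filter P? (map f xs)) ≡ length (filter (P? ∘ f) xs)
length-filter-map P? f []       = refl
length-filter-map P? f (x ∷ xs) with does (P? (f x))
... | true  = cong suc (length-filter-map P? f xs)
... | false = length-filter-map P? f xs

∈-allSubsets : ∀ {n} (X : Subset n) → X ∈ˡ allSubsets n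
∈-allSubsets []                    = here refl
∈-allSubsets {suc n} (outside ∷ X) = ∈-++⁺ˡ (∈-map⁺ (outside ∷_) (∈-allSubsets X))
∈-allSubsets {suc n} (inside ∷ X)  =
  ∈-++⁺ʳ (map (outside ∷_) (allSubsets n)) (∈-map⁺ (inside ∷_) (∈-allSubsets X))

module _ {n : ℕ} {P : Pred (Subset (suc n)) 0ℓ} (P? : Decidable P) where

  count-split : count P? ≡ count (P? ∘ (outside ∷_)) + count (P? ∘ (inside ∷_))
  count-split = begin
      length (filter P? (map (outside ∷_) Xs ++ map (inside ∷_) Xs))
    ≡⟨ cong length (filter-++ P? (map (outside ∷_) Xs) _) ⟩
      length (filter P? (map (outside ∷_) Xs) ++ filter P? (map (inside ∷_) Xs))
    ≡⟨ length-++ (filter P? (map (outside ∷_) Xs)) ⟩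
      length (filter P? (map (outside ∷_) Xs)) + length (filter P? (map (inside ∷_) Xs))
    ≡⟨ cong₂ _+_ (length-filter-map P? (outside ∷_) Xs) (length-filter-map P? (inside ∷_) Xs) ⟩
      count (P? ∘ (outside ∷_)) + count (P? ∘ (inside ∷_))
    ∎
    where
    open ≡-Reasoning
    Xs = allSubsets n

  count-split-≤ : ∀ {a b} → count (P? ∘ (outside ∷_)) ≤ a → count (P? ∘ (inside ∷_)) ≤ b →
                  count P? ≤ a + b
  count-split-≤ out≤a in≤b = ≤-trans (≤-reflexive count-split) (+-mono-≤ out≤a in≤b)

  count-split-≥ : ∀ {a b} → a ≤ count (P? ∘ (outside ∷_)) → b ≤ count (P? ∘ (inside ∷_)) →
                  a + b ≤ count P?
  count-split-≥ a≤out b≤in = ≤-trans (+-mono-≤ a≤out b≤in) (≤-reflexive (sym count-split))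

  count-outside≤count : count (P? ∘ (outside ∷_)) ≤ count P?
  count-outside≤count = ≤-trans (m≤m+n _ _) (≤-reflexive (sym count-split))

  count-inside≤count : count (P? ∘ (inside ∷_)) ≤ count P?
  count-inside≤count = ≤-trans (m≤n+m _ _) (≤-reflexive (sym count-split))

module _ {n : ℕ} {P : Pred (Subset n) 0ℓ} (P? : Decidable P) where

  count-mono : {Q : Pred (Subset n) 0ℓ} (Q? : Decidable Q) → (∀ X → P X → Q X) → count P? ≤ count Q?
  count-mono Q? P⇒Q =
    Sublist.length-mono-≤
      (Sublist.filter⁺ P? Q? (λ { refl → P⇒Q _ }) (Sublist.⊆-refl {x = allSubsets n}))

  count-none : (∀ X → ¬ P X) → count P? ≡ 0
  count-none ¬P = cong length (filter-none P? (universal ¬P (allSubsets n)))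

module _ {n : ℕ} where

  ∪-lub : {p q r : Subset n} → p ⊆ r → q ⊆ r → p ∪ q ⊆ r
  ∪-lub {p} {q} p⊆r q⊆r x∈p∪q with x∈p∪q⁻ p q x∈p∪q
  ... | inj₁ x∈p = p⊆r x∈p
  ... | inj₂ x∈q = q⊆r x∈q

  x∈p⇒⁅x⁆⊆p : {x : Fin n} {p : Subset n} → x ∈ p → ⁅ x ⁆ ⊆ p
  x∈p⇒⁅x⁆⊆p {x} x∈p y∈⁅x⁆ = subst (_∈ _) (sym (x∈⁅y⁆⇒x≡y x y∈⁅x⁆)) x∈p

  p⊆⁅x⁆∪q∧x∉p⇒p⊆q : {x : Fin n} {p q : Subset n} → p ⊆ ⁅ x ⁆ ∪ q → x ∉ p → p ⊆ q
  p⊆⁅x⁆∪q∧x∉p⇒p⊆q {x} {p} {q} p⊆ x∉p {y} y∈p with x∈p∪q⁻ ⁅ x ⁆ q (p⊆ y∈p)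
  ... | inj₁ y∈⁅x⁆ = ⊥-elim (x∉p (subst (_∈ p) (x∈⁅y⁆⇒x≡y x y∈⁅x⁆) y∈p))
  ... | inj₂ y∈q   = y∈q

  x∈p∧q⊆p-x⇒⁅x⁆∪q⊆p : {x : Fin n} {p q : Subset n} → x ∈ p → q ⊆ p - x → ⁅ x ⁆ ∪ q ⊆ p
  x∈p∧q⊆p-x⇒⁅x⁆∪q⊆p {x} {p} x∈p q⊆p-x = ∪-lub (x∈p⇒⁅x⁆⊆p x∈p) (⊆-trans q⊆p-x (p─q⊆p p ⁅ x ⁆))

  p-x⊆q∧x∈q⇒p⊆q : {x : Fin n} {p q : Subset n} → p - x ⊆ q → x ∈ q → p ⊆ q
  p-x⊆q∧x∈q⇒p⊆q {x} p-x⊆q x∈q {y} y∈p with y ≟ᶠ x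
  ... | yes refl = x∈q
  ... | no y≢x   = p-x⊆q (x∈p∧x≢y⇒x∈p-y y∈p y≢x)

x∉p-x : ∀ {n} (x : Fin n) (p : Subset n) → x ∉ p - x
x∉p-x zero    (_ ∷ p) ()
x∉p-x (suc x) (_ ∷ p) (there x∈p-x) = x∉p-x x p x∈p-x

x∉p⇒∣⁅x⁆∪p∣≡1+∣p∣ : ∀ {n} (x : Fin n) (p : Subset n) → x ∉ p → ∣ ⁅ x ⁆ ∪ p ∣ ≡ suc ∣ p ∣
x∉p⇒∣⁅x⁆∪p∣≡1+∣p∣ zero    (inside ∷ p)  x∉p = ⊥-elim (x∉p here)
x∉p⇒∣⁅x⁆∪p∣≡1+∣p∣ zero    (outside ∷ p) _   = cong (suc ∘ ∣_∣) (∪-identityˡ p)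
x∉p⇒∣⁅x⁆∪p∣≡1+∣p∣ (suc x) (inside ∷ p)  x∉p = cong suc (x∉p⇒∣⁅x⁆∪p∣≡1+∣p∣ x p (x∉p ∘ there))
x∉p⇒∣⁅x⁆∪p∣≡1+∣p∣ (suc x) (outside ∷ p) x∉p = x∉p⇒∣⁅x⁆∪p∣≡1+∣p∣ x p (x∉p ∘ there)

module _ {n : ℕ} (M : Matroid n) where
  open Matroid M

  indepSubset? : ∀ X → Decidable (λ Y → Y ⊆ X × Indep Y)
  indepSubset? X Y = (Y ⊆? X) ×-dec Indep? Y

  ∣∣≤rank : ∀ {X Y} → Y ⊆ X → Indep Y → ∣ Y ∣ ≤ rank M X
  ∣∣≤rank {X} {Y} Y⊆X indY = All.lookup (foldr-forcesᵇ ⊔≤-split 0 _ ≤-refl)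
    (∈-map⁺ ∣_∣ (∈-filter⁺ (indepSubset? X) (∈-allSubsets Y) (Y⊆X , indY)))
    where
    ⊔≤-split : ∀ a b → a ⊔ b ≤ rank M X → a ≤ rank M X × b ≤ rank M X
    ⊔≤-split a b a⊔b≤r = m⊔n≤o⇒m≤o a b a⊔b≤r , m⊔n≤o⇒n≤o a b a⊔b≤r

  rank-attained : ∀ X → ∃ λ Y → Y ⊆ X × Indep Y × ∣ Y ∣ ≡ rank M X
  rank-attained X with foldr-selective ⊔-sel 0 (map ∣_∣ (filter (indepSubset? X) (allSubsets n)))
  ... | inj₁ r≡0 = ⊥ , ⊥⊆ , indep-∅ , trans (∣⊥∣≡0 n) (sym r≡0)
  ... | inj₂ r∈ with ∈-map⁻ ∣_∣ r∈
  ...   | Y , Y∈ , r≡∣Y∣ with ∈-filter⁻ (indepSubset? X) {xs = allSubsets n} Y∈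
  ...     | _ , Y⊆X , indY = Y , Y⊆X , indY , sym r≡∣Y∣

  rank-mono : ∀ {X Y} → X ⊆ Y → rank M X ≤ rank M Y
  rank-mono {X} X⊆Y with rank-attained X
  ... | Z , Z⊆X , indZ , ∣Z∣≡r = subst (_≤ _) ∣Z∣≡r (∣∣≤rank (⊆-trans Z⊆X X⊆Y) indZ)

  augment* : ∀ {I J} → Indep I → Indep J →
             ∃ λ K → Indep K × I ⊆ K × K ⊆ I ∪ J × ∣ J ∣ ≤ ∣ K ∣
  augment* {I} {J} indI indJ = go ∣ J ∣ indI (m≤m+n ∣ J ∣ ∣ I ∣)
    where
    ∣I+e∣-step : ∀ {k e I} → e ∉ I → suc k + ∣ I ∣ ≡ k + ∣ ⁅ e ⁆ ∪ I ∣
    ∣I+e∣-step {k} {e} {I} e∉I =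
      sym (trans (cong (k +_) (x∉p⇒∣⁅x⁆∪p∣≡1+∣p∣ e I e∉I)) (+-suc k ∣ I ∣))

    go : ∀ k {I} → Indep I → ∣ J ∣ ≤ k + ∣ I ∣ →
         ∃ λ K → Indep K × I ⊆ K × K ⊆ I ∪ J × ∣ J ∣ ≤ ∣ K ∣
    go k {I} indI ∣J∣≤k+∣I∣ with ∣ J ∣ ≤? ∣ I ∣
    ... | yes ∣J∣≤∣I∣ = I , indI , ⊆-refl , p⊆p∪q J , ∣J∣≤∣I∣
    go zero    indI ∣J∣≤∣I∣ | no ∣J∣≰∣I∣ = ⊥-elim (∣J∣≰∣I∣ ∣J∣≤∣I∣)
    go (suc k) {I} indI ∣J∣≤1+k+∣I∣ | no ∣J∣≰∣I∣ with augment indI indJ (≰⇒> ∣J∣≰∣I∣)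
    ... | e , e∈J , e∉I , indI+e with go k indI+e (subst (∣ J ∣ ≤_) (∣I+e∣-step e∉I) ∣J∣≤1+k+∣I∣)
    ...   | K , indK , I+e⊆K , K⊆I+e∪J , ∣J∣≤∣K∣ =
      K , indK , ⊆-trans (q⊆p∪q ⁅ e ⁆ I) I+e⊆K , ⊆-trans K⊆I+e∪J I+e∪J⊆I∪J , ∣J∣≤∣K∣
      where
      I+e∪J⊆I∪J : (⁅ e ⁆ ∪ I) ∪ J ⊆ I ∪ J
      I+e∪J⊆I∪J = ∪-lub (∪-lub (⊆-trans (x∈p⇒⁅x⁆⊆p e∈J) (q⊆p∪q I J)) (p⊆p∪q J)) (q⊆p∪q I J)

  dependent⇒circuit : ∀ {D} → ¬ Indep D → ∃ λ C → IsCircuit M C × C ⊆ D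
  dependent⇒circuit {D} = go ∣ D ∣ ≤-refl
    where
    go : ∀ k {D} → ∣ D ∣ ≤ k → ¬ Indep D → ∃ λ C → IsCircuit M C × C ⊆ D
    go k {D} ∣D∣≤k depD with anySubset? (λ X → (X ⊂? D) ×-dec ¬? (Indep? X))
    ... | no ¬smaller = D , (depD , minimal) , ⊆-refl
      where
      minimal : ∀ X → X ⊂ D → Indep X
      minimal X X⊂D = decidable-stable (Indep? X) (λ depX → ¬smaller (X , X⊂D , depX))
    go zero    ∣D∣≤0 _ | yes (X , X⊂D , _) = ⊥-elim (n≮0 (<-≤-trans (p⊂q⇒∣p∣<∣q∣ X⊂D) ∣D∣≤0))
    go (suc k) ∣D∣≤k _ | yes (X , X⊂D , depX)
      with go k (≤-pred (<-≤-trans (p⊂q⇒∣p∣<∣q∣ X⊂D) ∣D∣≤k)) depX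
    ... | C , circC , C⊆X = C , circC , ⊆-trans C⊆X (p⊂q⇒p⊆q X⊂D)

  fundamentalCircuit : ∀ {I} e → Indep I → ¬ Indep (⁅ e ⁆ ∪ I) →
                       ∃ λ C → IsCircuit M C × e ∈ C × C ⊆ ⁅ e ⁆ ∪ I
  fundamentalCircuit e indI dep with dependent⇒circuit dep
  ... | C , circC , C⊆I+e with e ∈? C
  ...   | yes e∈C = C , circC , e∈C , C⊆I+e
  ...   | no e∉C  = ⊥-elim (proj₁ circC (indep-⊆ (p⊆⁅x⁆∪q∧x∉p⇒p⊆q C⊆I+e e∉C) indI))

  circuit⇒rank[F]≤rank[F-e] : ∀ {C e F} → IsCircuit M C → e ∈ C → C ⊆ F → rank M F ≤ rank M (F - e)
  circuit⇒rank[F]≤rank[F-e] {C} {e} {F} (depC , minC) e∈C C⊆F with rank-attained F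
  ... | I , I⊆F , indI , ∣I∣≡r with augment* (minC (C - e) (x∈p⇒p-x⊂p e∈C)) indI
  ...   | K , indK , C-e⊆K , K⊆C-e∪I , ∣I∣≤∣K∣ = begin
      rank M F        ≡⟨ sym ∣I∣≡r ⟩
      ∣ I ∣           ≤⟨ ∣I∣≤∣K∣ ⟩
      ∣ K ∣           ≤⟨ ∣∣≤rank K⊆F-e indK ⟩
      rank M (F - e)  ∎
    where
    open ≤-Reasoning
    e∉K : e ∉ K
    e∉K e∈K = depC (indep-⊆ (p-x⊆q∧x∈q⇒p⊆q C-e⊆K e∈K) indK)
    K⊆F-e : K ⊆ F - e
    K⊆F-e x∈K = x∈p∧x≢y⇒x∈p-y (⊆-trans K⊆C-e∪I (∪-lub (⊆-trans (p─q⊆p C ⁅ e ⁆) C⊆F) I⊆F) x∈K)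
                              (λ { refl → e∉K x∈K })

  rank[F]≤rank[F-e]⇒circuit : ∀ {e F} → e ∈ F → rank M F ≤ rank M (F - e) →
                              ∃ λ C → IsCircuit M C × e ∈ C × C ⊆ F
  rank[F]≤rank[F-e]⇒circuit {e} {F} e∈F r[F]≤r[F-e] with rank-attained (F - e)
  ... | J , J⊆F-e , indJ , ∣J∣≡r with Indep? (⁅ e ⁆ ∪ J)
  ...   | yes indJ+e = ⊥-elim (n≮n _ (begin-strict
      rank M (F - e)  ≡⟨ sym ∣J∣≡r ⟩
      ∣ J ∣           <⟨ n<1+n _ ⟩
      suc ∣ J ∣       ≡⟨ sym (x∉p⇒∣⁅x⁆∪p∣≡1+∣p∣ e J (λ e∈J → x∉p-x e F (J⊆F-e e∈J))) ⟩
      ∣ ⁅ e ⁆ ∪ J ∣   ≤⟨ ∣∣≤rank (x∈p∧q⊆p-x⇒⁅x⁆∪q⊆p e∈F J⊆F-e) indJ+e ⟩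
      rank M F        ≤⟨ r[F]≤r[F-e] ⟩
      rank M (F - e)  ∎))
    where open ≤-Reasoning
  ...   | no depJ+e with fundamentalCircuit e indJ depJ+e
  ...     | C , circC , e∈C , C⊆J+e = C , circC , e∈C , ⊆-trans C⊆J+e (x∈p∧q⊆p-x⇒⁅x⁆∪q⊆p e∈F J⊆F-e)

  rank≤∣basis∣ : ∀ {B} → IsBasis M B → ∀ X → rank M X ≤ ∣ B ∣
  rank≤∣basis∣ {B} (indB , maxB) X with rank-attained X
  ... | Y , _ , indY , ∣Y∣≡r with ∣ Y ∣ ≤? ∣ B ∣
  ...   | yes ∣Y∣≤∣B∣ = subst (_≤ ∣ B ∣) ∣Y∣≡r ∣Y∣≤∣B∣
  ...   | no ∣Y∣≰∣B∣ with augment indB indY (≰⇒> ∣Y∣≰∣B∣)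
  ...     | e , _ , e∉B , indB+e =
    ⊥-elim (e∉B (subst (e ∈_) (maxB _ (q⊆p∪q ⁅ e ⁆ B) indB+e) (p⊆p∪q B (x∈⁅x⁆ e))))

  InCircuit : Pred (Fin n) 0ℓ
  InCircuit e = ∃ λ C → IsCircuit M C × e ∈ C

  inCircuit? : Decidable InCircuit
  inCircuit? e = anySubset? (λ C → isCircuit? M C ×-dec (e ∈? C))

  ¬inCircuit⇒indep-∪ : ∀ {e J} → ¬ InCircuit e → Indep J → Indep (⁅ e ⁆ ∪ J)
  ¬inCircuit⇒indep-∪ {e} {J} coloop indJ with Indep? (⁅ e ⁆ ∪ J)
  ... | yes indJ+e = indJ+e
  ... | no depJ+e with fundamentalCircuit e indJ depJ+e
  ...   | C , circC , e∈C , _ = ⊥-elim (coloop (C , circC , e∈C))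

  rank-∪-loop : ∀ {e} → ¬ Indep ⁅ e ⁆ → ∀ X → rank M (⁅ e ⁆ ∪ X) ≤ rank M X
  rank-∪-loop {e} loop X with rank-attained (⁅ e ⁆ ∪ X)
  ... | Y , Y⊆X+e , indY , ∣Y∣≡r = subst (_≤ _) ∣Y∣≡r (∣∣≤rank (p⊆⁅x⁆∪q∧x∉p⇒p⊆q Y⊆X+e e∉Y) indY)
    where
    e∉Y : e ∉ Y
    e∉Y e∈Y = loop (indep-⊆ (x∈p⇒⁅x⁆⊆p e∈Y) indY)

  loop∈flat : ∀ {e F} → ¬ Indep ⁅ e ⁆ → IsFlat M F → e ∈ F
  loop∈flat {e} {F} loop flat =
    decidable-stable (e ∈? F) (λ e∉F → <⇒≱ (flat e e∉F) (rank-∪-loop loop F))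

cyclicFlat-transfer : ∀ {n} (M : Matroid (suc n)) (N : Matroid n) (s : Side) (c : ℕ) →
                      (∀ X → c + rank N X ≡ rank M (s ∷ X)) →
                      ∀ F → IsCyclicFlat M (s ∷ F) → IsCyclicFlat N F
cyclicFlat-transfer M N s c c+rN≡rM F (flat , cyclic) = flat′ , cyclic′
  where
  -- ⁅ suc e ⁆ ∪ (s ∷ F) and (s ∷ F) - suc e compute to s ∷ (⁅ e ⁆ ∪ F) and s ∷ (F - e).
  flat′ : IsFlat N F
  flat′ e e∉F = +-cancelˡ-< c _ _
    (subst₂ _<_ (sym (c+rN≡rM F)) (sym (c+rN≡rM (⁅ e ⁆ ∪ F))) (flat (suc e) (e∉F ∘ drop-there)))
  cyclic′ : IsUnionOfCircuits N F
  cyclic′ e e∈F with cyclic (suc e) (there e∈F)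
  ... | C , circC , e∈C , C⊆F = rank[F]≤rank[F-e]⇒circuit N e∈F (+-cancelˡ-≤ c _ _
    (subst₂ _≤_ (sym (c+rN≡rM F)) (sym (c+rN≡rM (F - e)))
      (circuit⇒rank[F]≤rank[F-e] M circC e∈C C⊆F)))

module _ {n : ℕ} (M : Matroid (suc n)) where
  open Matroid M

  delete₀ : Matroid n
  delete₀ = record
    { Indep   = Indep ∘ (outside ∷_)
    ; Indep?  = Indep? ∘ (outside ∷_)
    ; indep-∅ = indep-∅
    ; indep-⊆ = indep-⊆ ∘ s⊆s
    ; augment = augment′
    }
    where
    augment′ : ∀ {X Y} → Indep (outside ∷ X) → Indep (outside ∷ Y) → ∣ X ∣ < ∣ Y ∣ →
               ∃ λ e → e ∈ Y × e ∉ X × Indep (outside ∷ (⁅ e ⁆ ∪ X))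
    augment′ indX indY ∣X∣<∣Y∣ with augment indX indY ∣X∣<∣Y∣
    ... | suc e , there e∈Y , e∉X , indX+e = e , e∈Y , e∉X ∘ there , indX+e

  contract₀ : Indep ⁅ zero ⁆ → Matroid n
  contract₀ nonloop = record
    { Indep   = Indep ∘ (inside ∷_)
    ; Indep?  = Indep? ∘ (inside ∷_)
    ; indep-∅ = nonloop
    ; indep-⊆ = indep-⊆ ∘ s⊆s
    ; augment = augment′
    }
    where
    augment′ : ∀ {X Y} → Indep (inside ∷ X) → Indep (inside ∷ Y) → ∣ X ∣ < ∣ Y ∣ →
               ∃ λ e → e ∈ Y × e ∉ X × Indep (inside ∷ (⁅ e ⁆ ∪ X))
    augment′ indX indY ∣X∣<∣Y∣ with augment indX indY (s≤s ∣X∣<∣Y∣)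
    ... | zero  , _         , e∉X , _      = ⊥-elim (e∉X here)
    ... | suc e , there e∈Y , e∉X , indX+e = e , e∈Y , e∉X ∘ there , indX+e

  rank-delete₀ : ∀ X → rank delete₀ X ≡ rank M (outside ∷ X)
  rank-delete₀ X = ≤-antisym rD≤rM rM≤rD
    where
    rD≤rM : rank delete₀ X ≤ rank M (outside ∷ X)
    rD≤rM with rank-attained delete₀ X
    ... | Y , Y⊆X , indY , ∣Y∣≡r = subst (_≤ _) ∣Y∣≡r (∣∣≤rank M (s⊆s Y⊆X) indY)
    rM≤rD : rank M (outside ∷ X) ≤ rank delete₀ X
    rM≤rD with rank-attained M (outside ∷ X)
    ... | outside ∷ Y , Y⊆X , indY , ∣Y∣≡r =
      subst (_≤ _) ∣Y∣≡r (∣∣≤rank delete₀ (drop-∷-⊆ Y⊆X) indY)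
    ... | inside ∷ Y  , Y⊆X , _    , _     with Y⊆X here
    ...   | ()

  rank-contract₀ : ∀ nonloop X → suc (rank (contract₀ nonloop) X) ≡ rank M (inside ∷ X)
  rank-contract₀ nonloop X = ≤-antisym 1+rC≤rM rM≤1+rC
    where
    1+rC≤rM : suc (rank (contract₀ nonloop) X) ≤ rank M (inside ∷ X)
    1+rC≤rM with rank-attained (contract₀ nonloop) X
    ... | Y , Y⊆X , indY , ∣Y∣≡r = subst (λ r → suc r ≤ _) ∣Y∣≡r (∣∣≤rank M (s⊆s Y⊆X) indY)
    rM≤1+rC : rank M (inside ∷ X) ≤ suc (rank (contract₀ nonloop) X)
    rM≤1+rC with rank-attained M (inside ∷ X)
    ... | Y , Y⊆X , indY , ∣Y∣≡r with augment* M nonloop indY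
    ...   | outside ∷ K , _ , 0∈K , _ , _ with 0∈K here
    ...     | ()
    rM≤1+rC | Y , Y⊆X , indY , ∣Y∣≡r | inside ∷ K , indK , _ , K⊆0∪Y , ∣Y∣≤∣K∣ =
      subst (_≤ _) ∣Y∣≡r (≤-trans ∣Y∣≤∣K∣ (s≤s (∣∣≤rank (contract₀ nonloop) K⊆X indK)))
      where
      K⊆X : K ⊆ X
      K⊆X = drop-∷-⊆ (⊆-trans K⊆0∪Y (∪-lub (s⊆s ⊥⊆) Y⊆X))

  rank-∷-loop : ¬ Indep ⁅ zero ⁆ → ∀ X → rank M (inside ∷ X) ≡ rank M (outside ∷ X)
  rank-∷-loop loop X = ≤-antisym
    (≤-trans (rank-mono M (s⊆s (q⊆p∪q ⊥ X))) (rank-∪-loop M {zero} loop (outside ∷ X)))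
    (rank-mono M (out⊆ ⊆-refl))

  basis-delete₀ : ∀ {B} → IsBasis delete₀ B → ¬ Indep (inside ∷ B) → IsBasis M (outside ∷ B)
  basis-delete₀ {B} (indB , maxB) depB+0 = indB , maximal
    where
    maximal : ∀ X → outside ∷ B ⊆ X → Indep X → X ≡ outside ∷ B
    maximal (outside ∷ X) B⊆X indX = cong (outside ∷_) (maxB X (drop-∷-⊆ B⊆X) indX)
    maximal (inside ∷ X)  B⊆X indX = ⊥-elim (depB+0 (subst (Indep ∘ (inside ∷_)) X≡B indX))
      where
      X≡B : X ≡ B
      X≡B = maxB X (drop-∷-⊆ B⊆X) (indep-⊆ (out⊆ ⊆-refl) indX)

  basis-contract₀ : ∀ nonloop {B} → IsBasis (contract₀ nonloop) B → IsBasis M (inside ∷ B)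
  basis-contract₀ _ {B} (indB , maxB) = indB , maximal
    where
    maximal : ∀ X → inside ∷ B ⊆ X → Indep X → X ≡ inside ∷ B
    maximal (inside ∷ X)  B⊆X indX = cong (inside ∷_) (maxB X (drop-∷-⊆ B⊆X) indX)
    maximal (outside ∷ X) B⊆X _ with B⊆X here
    ... | ()

  basis-delete₀⇒basis-contract₀ : ∀ nonloop → ¬ InCircuit M zero →
                                  ∀ {B} → IsBasis delete₀ B → IsBasis (contract₀ nonloop) B
  basis-delete₀⇒basis-contract₀ _ coloop {B} (indB , maxB) =
    subst (Indep ∘ (inside ∷_)) (∪-identityˡ B) (¬inCircuit⇒indep-∪ M coloop indB) ,
    λ X B⊆X indX → maxB X B⊆X (indep-⊆ (out⊆ ⊆-refl) indX)

  inCircuit⇒basis-delete₀-spans₀ : InCircuit M zero →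
                                   ∀ {B} → IsBasis delete₀ B → ¬ Indep (inside ∷ B)
  inCircuit⇒basis-delete₀-spans₀ (C , circC , 0∈C) {B} basisB indB+0 = n≮n _ (begin-strict
    ∣ B ∣                 <⟨ n<1+n _ ⟩
    ∣ inside ∷ B ∣        ≤⟨ ∣∣≤rank M ⊆⊤ indB+0 ⟩
    rank M ⊤              ≤⟨ circuit⇒rank[F]≤rank[F-e] M circC 0∈C ⊆⊤ ⟩
    rank M (⊤ - zero)     ≡⟨ sym (rank-delete₀ _) ⟩
    rank delete₀ (⊤ ─ ⊥)  ≤⟨ rank≤∣basis∣ delete₀ basisB _ ⟩
    ∣ B ∣                 ∎)
    where open ≤-Reasoning

  numCyclicFlats-loop : ¬ Indep ⁅ zero ⁆ → numCyclicFlats M ≤ numCyclicFlats delete₀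
  numCyclicFlats-loop loop = count-split-≤ (isCyclicFlat? M)
    (≤-reflexive (count-none (isCyclicFlat? M ∘ (outside ∷_)) ¬cyclicFlat))
    (count-mono _ (isCyclicFlat? delete₀) (cyclicFlat-transfer M delete₀ inside 0 rank-delete₀≡))
    where
    ¬cyclicFlat : ∀ F → ¬ IsCyclicFlat M (outside ∷ F)
    ¬cyclicFlat F (flat , _) with loop∈flat M {zero} loop flat
    ... | ()
    rank-delete₀≡ : ∀ X → rank delete₀ X ≡ rank M (inside ∷ X)
    rank-delete₀≡ X = trans (rank-delete₀ X) (sym (rank-∷-loop loop X))

  numBases-loop : ¬ Indep ⁅ zero ⁆ → numBases delete₀ ≤ numBases M
  numBases-loop loop = ≤-trans
    (count-mono _ (isBasis? M ∘ (outside ∷_))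
      (λ B basisB → basis-delete₀ basisB (loop ∘ indep-⊆ (s⊆s ⊥⊆))))
    (count-outside≤count (isBasis? M))

  numCyclicFlats-coloop : ¬ InCircuit M zero → numCyclicFlats M ≤ numCyclicFlats delete₀
  numCyclicFlats-coloop coloop = ≤-trans
    (count-split-≤ (isCyclicFlat? M)
      (count-mono _ (isCyclicFlat? delete₀) (cyclicFlat-transfer M delete₀ outside 0 rank-delete₀))
      (≤-reflexive (count-none (isCyclicFlat? M ∘ (inside ∷_)) ¬cyclicFlat)))
    (≤-reflexive (+-identityʳ _))
    where
    ¬cyclicFlat : ∀ F → ¬ IsCyclicFlat M (inside ∷ F)
    ¬cyclicFlat F (_ , cyclic) with cyclic zero here
    ... | C , circC , 0∈C , _ = coloop (C , circC , 0∈C)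

  numBases-coloop : ∀ nonloop → ¬ InCircuit M zero → numBases delete₀ ≤ numBases M
  numBases-coloop nonloop coloop = ≤-trans
    (count-mono _ (isBasis? M ∘ (inside ∷_))
      (λ B → basis-contract₀ nonloop ∘ basis-delete₀⇒basis-contract₀ nonloop coloop))
    (count-inside≤count (isBasis? M))

  numCyclicFlats-deletion-contraction :
    ∀ nonloop → numCyclicFlats M ≤ numCyclicFlats delete₀ + numCyclicFlats (contract₀ nonloop)
  numCyclicFlats-deletion-contraction nonloop = count-split-≤ (isCyclicFlat? M)
    (count-mono _ (isCyclicFlat? delete₀) (cyclicFlat-transfer M delete₀ outside 0 rank-delete₀))
    (count-mono _ (isCyclicFlat? (contract₀ nonloop))
      (cyclicFlat-transfer M (contract₀ nonloop) inside 1 (rank-contract₀ nonloop)))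

  numBases-deletion-contraction :
    ∀ nonloop → InCircuit M zero → numBases delete₀ + numBases (contract₀ nonloop) ≤ numBases M
  numBases-deletion-contraction nonloop inCircuit = count-split-≥ (isBasis? M)
    (count-mono _ (isBasis? M ∘ (outside ∷_))
      (λ B basisB → basis-delete₀ basisB (inCircuit⇒basis-delete₀-spans₀ inCircuit basisB)))
    (count-mono _ (isBasis? M ∘ (inside ∷_)) (λ B → basis-contract₀ nonloop))

proposition1 : ∀ (n : ℕ) (M : Matroid n) → numCyclicFlats M ≤ numBases M
proposition1 zero    M = count-mono (isCyclicFlat? M) (isBasis? M)
  λ { [] _ → Matroid.indep-∅ M , λ { [] _ _ → refl } }
proposition1 (suc n) M with Matroid.Indep? M ⁅ zero ⁆ | inCircuit? M zero
... | no loop | _ = begin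
  numCyclicFlats M           ≤⟨ numCyclicFlats-loop M loop ⟩
  numCyclicFlats (delete₀ M) ≤⟨ proposition1 n (delete₀ M) ⟩
  numBases (delete₀ M)       ≤⟨ numBases-loop M loop ⟩
  numBases M                 ∎
  where open ≤-Reasoning
... | yes nonloop | no coloop = begin
  numCyclicFlats M           ≤⟨ numCyclicFlats-coloop M coloop ⟩
  numCyclicFlats (delete₀ M) ≤⟨ proposition1 n (delete₀ M) ⟩
  numBases (delete₀ M)       ≤⟨ numBases-coloop M nonloop coloop ⟩
  numBases M                 ∎
  where open ≤-Reasoning
... | yes nonloop | yes inCircuit = begin
  numCyclicFlats M
    ≤⟨ numCyclicFlats-deletion-contraction M nonloop ⟩
  numCyclicFlats (delete₀ M) + numCyclicFlats (contract₀ M nonloop)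
    ≤⟨ +-mono-≤ (proposition1 n (delete₀ M)) (proposition1 n (contract₀ M nonloop)) ⟩
  numBases (delete₀ M) + numBases (contract₀ M nonloop)
    ≤⟨ numBases-deletion-contraction M nonloop inCircuit ⟩
  numBases M
    ∎
  where open ≤-Reasoning
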